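{- Let $n\ge2$, $m\ge 0$ and let $k$ be an integer with $1\le k\le n/2$. Then \[ \mathbb{P}\Bigl(\bigcup_{j=1}^k A_{j}\Bigr)=\mathbb{P}\Bigl(\bigcup_{j=1}^k A_{n-j}\Bigr), \] where $A_i$ is the event that $\boldsymbol\sigma(n,m)$ is decomposable at position $i$.
   Context: $\boldsymbol\sigma(n,m)$ is a uniformly random permutation of $[n]$ with exactly $m$ inversions (pairs of positions $i<j$ with $\sigma(i)>\sigma(j)$). A permutation $\boldsymbol\sigma$ of $[n]$ is decomposable at position $i\in[n-1]$ if $\{\sigma(1),\dots,\sigma(i)\}=\{1,\dots,i\}$. -}

module Defs where

open import Data.Nat using (ℕ; zero; suc; _+_; _∸_; _≡ᵇ_; _<ᵇ_)
open import Data.Bool using (Bool; true; false; _∧_; _∨_; not)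
open import Data.Fin using (Fin; toℕ)
open import Data.Vec using (Vec; []; _∷_; lookup)
open import Data.List using (List; []; _∷_; [_]; map; concatMap; allFin; length; filterᵇ; applyUpTo)
open import Data.Bool.ListAction using (any; all)

-- A permutation of [n] is represented (0-indexed) by its one-line notation:
-- a vector v of length n with entries in Fin n, σ(p+1) = toℕ (lookup v p) + 1.

allVecs : (n k : ℕ) → List (Vec (Fin n) k)
allVecs n zero    = [ [] ]
allVecs n (suc k) = concatMap (λ x → map (x ∷_) (allVecs n k)) (allFin n)

_==ᶠ_ : ∀ {n} → Fin n → Fin n → Bool
a ==ᶠ b = toℕ a ≡ᵇ toℕ b

isPerm : ∀ {n} → Vec (Fin n) n → Bool
isPerm {n} v =
  all (λ i → all (λ j → (i ==ᶠ j) ∨ not (lookup v i ==ᶠ lookup v j)) (allFin n)) (allFin n)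

inversions : ∀ {n} → Vec (Fin n) n → ℕ
inversions {n} v =
  length (concatMap (λ i → filterᵇ (λ j → (toℕ i <ᵇ toℕ j) ∧ (toℕ (lookup v j) <ᵇ toℕ (lookup v i))) (allFin n))
                    (allFin n))

inPrefix : ∀ {n} → Vec (Fin n) n → ℕ → Fin n → Bool
inPrefix {n} v i x = any (λ p → (toℕ p <ᵇ i) ∧ (lookup v p ==ᶠ x)) (allFin n)

-- decomposable at position i: {σ(1),…,σ(i)} = {1,…,i}
-- (set equality, checked elementwise over all values in [n])
decomposableAt : ∀ {n} → Vec (Fin n) n → ℕ → Bool
decomposableAt {n} v i =
  all (λ x → (inPrefix v i x ∧ (toℕ x <ᵇ i)) ∨ (not (inPrefix v i x) ∧ not (toℕ x <ᵇ i))) (allFin n)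

oneTo : ℕ → List ℕ
oneTo k = applyUpTo suc k

unionLow : ∀ {n} → ℕ → Vec (Fin n) n → Bool
unionLow k v = any (λ j → decomposableAt v j) (oneTo k)

unionHigh : ∀ {n} → ℕ → Vec (Fin n) n → Bool
unionHigh {n} k v = any (λ j → decomposableAt v (n ∸ j)) (oneTo k)

-- number of permutations of [n] with exactly m inversions satisfying the event E
-- (P(E) for σ(n,m) uniform is this count divided by the total count)
countEvent : (n m : ℕ) → (Vec (Fin n) n → Bool) → ℕ
countEvent n m E = length (filterᵇ (λ v → isPerm v ∧ (inversions v ≡ᵇ m) ∧ E v) (allVecs n n))

countAll : (n m : ℕ) → ℕ
countAll n m = countEvent n m (λ _ → true)

module Submission where

-- The reverse-complement of a permutation σ of [n] is ρσ(p) = n+1−σ(n+1−p),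
-- i.e. ρσ = opp ∘ σ ∘ opp with opp(p) = n+1−p.  ρ is an involution which
--   (1) maps permutations to permutations,
--   (2) preserves the number of inversions, because (i,j) is an inversion of σ
--       exactly when (opp j, opp i) is an inversion of ρσ, and
--   (3) makes σ decomposable at i exactly when ρσ is decomposable at n − i:
--       positions < i are mapped to values < i iff positions ≥ i are mapped
--       to values ≥ i, and opp exchanges these two ranges with [0, n−i).
-- Hence ρ carries the event ⋃_{j≤k} A_j onto ⋃_{j≤k} A_{n−j} inside the
-- permutations with m inversions, and two Boolean predicates exchanged by an
-- involution have the same number of solutions in any duplicate-free
-- enumeration.  The file first develops Boolean reflection for the list
-- quantifiers used in Defs, then counting under involutions and the
-- enumeration of vectors, then facts (1)–(3), and finally the corollary.
-- The identity holds for every k.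

open import Defs
open import Data.Nat using (ℕ; zero; suc; _+_; _∸_; _≤_; _<_; _*_; _≡ᵇ_; _<ᵇ_; s≤s)
open import Data.Nat.Properties
  using (<ᵇ-reflects-<; ≡ᵇ⇒≡; ≡⇒≡ᵇ; ∸-monoʳ-<; ∸-monoʳ-≤; ≮⇒≥; <⇒≱; 1+n≰n)
open import Data.Bool using (Bool; true; false; _∧_; _∨_; not)
open import Data.Bool.Properties using (∨-comm; not-injective)
open import Data.Bool.ListAction using (any; all; or)
open import Data.Empty using (⊥-elim)
open import Data.Product using (∃; ∃₂; _×_; _,_; uncurry)
open import Data.Fin using (Fin; toℕ; opposite; punchOut)
open import Data.Fin.Properties
  using (toℕ-injective; toℕ<n; opposite-prop; opposite-involutive; any?; _≟_; punchOut-injective; injective⇒≤)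
open import Data.Vec using (Vec; []; _∷_; lookup; tabulate)
open import Data.Vec.Properties using (lookup∘tabulate; tabulate∘lookup; tabulate-cong; ∷-injective)
open import Data.List using (List; []; _∷_; map; filterᵇ; length; _++_; concatMap; allFin; cartesianProduct; cartesianProductWith)
open import Data.List.Properties using (length-++; filter-++; map-cong)
open import Data.List.Relation.Unary.All using (All; uncons) renaming ([] to []ᴬ; _∷_ to _∷ᴬ_)
open import Data.List.Relation.Unary.Any using (Any; here; toSum; fromSum)
import Data.List.Relation.Unary.AllPairs as AllPairs
import Data.List.Relation.Unary.All.Properties as All
import Data.List.Relation.Unary.Any.Properties as Any
open import Data.List.Relation.Unary.Unique.Propositional using (Unique)
import Data.List.Relation.Unary.Unique.Propositional.Properties as Unique
open import Data.List.Membership.Propositional using (_∈_)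
open import Data.List.Membership.Propositional.Properties
  using (∈-map⁺; ∈-allFin; ∈-cartesianProductWith⁺)
open import Data.List.Membership.Propositional.Properties.WithK using (unique∧set⇒bag)
open import Data.List.Relation.Binary.BagAndSetEquality using (∼bag⇒↭)
open import Data.List.Relation.Binary.Permutation.Propositional using (_↭_)
open import Data.List.Relation.Binary.Permutation.Propositional.Properties using (↭-length; filter-↭)
open import Function using (_∘_)
open import Function.Bundles using (mk⇔)
open import Function.Definitions using (Injective)
open import Algebra.Definitions using (Involutive)
open import Relation.Nullary using (¬_; yes; no)
open import Relation.Nullary.Decidable using (T?)
open import Relation.Nullary.Reflects
  using (Reflects; ofʸ; ofⁿ; det; fromEquivalence; ¬-reflects; _×-reflects_; _⊎-reflects_; _→-reflects_)
open import Relation.Binary.PropositionalEquality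
  using (_≡_; refl; sym; trans; cong; cong₂; subst; module ≡-Reasoning)

private
  variable
    A B C : Set
    a b : Bool
    n : ℕ

reflects-map : {P Q : Set} → (P → Q) → (Q → P) → Reflects P b → Reflects Q b
reflects-map f g (ofʸ p)  = ofʸ (f p)
reflects-map f g (ofⁿ ¬p) = ofⁿ (¬p ∘ g)

same-truth : {P Q : Set} → Reflects P a → Reflects Q b → (P → Q) → (Q → P) → a ≡ b
same-truth rP rQ f g = det (reflects-map f g rP) rQ

all-reflects : {P : A → Set} {p : A → Bool} →
  (∀ x → Reflects (P x) (p x)) → ∀ xs → Reflects (All P xs) (all p xs)
all-reflects r []       = ofʸ []ᴬ
all-reflects r (x ∷ xs) = reflects-map (uncurry _∷ᴬ_) uncons (r x ×-reflects all-reflects r xs)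

any-reflects : {P : A → Set} {p : A → Bool} →
  (∀ x → Reflects (P x) (p x)) → ∀ xs → Reflects (Any P xs) (any p xs)
any-reflects r []       = ofⁿ λ ()
any-reflects r (x ∷ xs) = reflects-map fromSum toSum (r x ⊎-reflects any-reflects r xs)

∀Fin-reflects : {P : Fin n → Set} {p : Fin n → Bool} →
  (∀ i → Reflects (P i) (p i)) → Reflects (∀ i → P i) (all p (allFin n))
∀Fin-reflects r = reflects-map All.tabulate⁻ All.tabulate⁺ (all-reflects r (allFin _))

∃Fin-reflects : {P : Fin n → Set} {p : Fin n → Bool} →
  (∀ i → Reflects (P i) (p i)) → Reflects (∃ P) (any p (allFin n))
∃Fin-reflects r = reflects-map Any.tabulate⁻ (uncurry Any.tabulate⁺) (any-reflects r (allFin _))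

-- Implication, written b ∨ not a as in the definition of isPerm.
⇒-reflects : {P Q : Set} → Reflects P a → Reflects Q b → Reflects (P → Q) (b ∨ not a)
⇒-reflects {a = a} {b = b} rP rQ = subst (Reflects _) (∨-comm (not a) b) (rP →-reflects rQ)

-- "a and b agree", written as in the definition of decomposableAt.
xnor-reflects : ∀ a b → Reflects (a ≡ b) ((a ∧ b) ∨ (not a ∧ not b))
xnor-reflects true  true  = ofʸ refl
xnor-reflects true  false = ofⁿ λ ()
xnor-reflects false true  = ofⁿ λ ()
xnor-reflects false false = ofʸ refl

==ᶠ-reflects : (x y : Fin n) → Reflects (x ≡ y) (x ==ᶠ y)
==ᶠ-reflects x y = fromEquivalence (toℕ-injective ∘ ≡ᵇ⇒≡ _ _) (λ e → ≡⇒≡ᵇ _ _ (cong toℕ e))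

record IsEnumeration {A : Set} (xs : List A) : Set where
  field
    unique   : Unique xs
    complete : ∀ x → x ∈ xs
open IsEnumeration

involutive⇒injective : (f : A → A) → Involutive _≡_ f → Injective _≡_ _≡_ f
involutive⇒injective f inv {x} {y} e = trans (sym (inv x)) (trans (cong f e) (inv y))

map-involution-↭ : {xs : List A} → IsEnumeration xs →
  (f : A → A) → Involutive _≡_ f → map f xs ↭ xs
map-involution-↭ {xs = xs} enum f inv = ∼bag⇒↭ (unique∧set⇒bag
  (Unique.map⁺ (involutive⇒injective f inv) (unique enum)) (unique enum)
  (λ {x} → mk⇔ (λ _ → complete enum x)
                (λ _ → subst (_∈ map f xs) (inv x) (∈-map⁺ f (complete enum (f x))))))

filterᵇ-cong : {p q : A → Bool} → (∀ x → p x ≡ q x) → ∀ xs → filterᵇ p xs ≡ filterᵇ q xs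
filterᵇ-cong e [] = refl
filterᵇ-cong {p = p} {q} e (x ∷ xs) with p x | q x | e x
... | true  | true  | _ = cong (x ∷_) (filterᵇ-cong e xs)
... | false | false | _ = filterᵇ-cong e xs

length-filter-map : (p : B → Bool) (f : A → B) (xs : List A) →
  length (filterᵇ p (map f xs)) ≡ length (filterᵇ (p ∘ f) xs)
length-filter-map p f [] = refl
length-filter-map p f (x ∷ xs) with p (f x)
... | true  = cong suc (length-filter-map p f xs)
... | false = length-filter-map p f xs

count-involution : {xs : List A} {p q : A → Bool} → IsEnumeration xs →
  (f : A → A) → Involutive _≡_ f → (∀ x → p x ≡ q (f x)) →
  length (filterᵇ p xs) ≡ length (filterᵇ q xs)
count-involution {xs = xs} {p} {q} enum f inv e = begin
  length (filterᵇ p xs)          ≡⟨ cong length (filterᵇ-cong e xs) ⟩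
  length (filterᵇ (q ∘ f) xs)    ≡⟨ length-filter-map q f xs ⟨
  length (filterᵇ q (map f xs))  ≡⟨ ↭-length (filter-↭ (T? ∘ q) (map-involution-↭ enum f inv)) ⟩
  length (filterᵇ q xs)          ∎
  where open ≡-Reasoning

enumeration-cartesianProductWith : {xs : List A} {ys : List B} (f : A → B → C) →
  (∀ {w x y z} → f w y ≡ f x z → w ≡ x × y ≡ z) → (∀ c → ∃₂ λ x y → f x y ≡ c) →
  IsEnumeration xs → IsEnumeration ys → IsEnumeration (cartesianProductWith f xs ys)
enumeration-cartesianProductWith {xs = xs} {ys} f f-injective f-onto ex ey = record
  { unique   = Unique.cartesianProductWith⁺ f f-injective (unique ex) (unique ey)
  ; complete = λ c → member c (f-onto c)
  }
  where
  member : ∀ c → (∃₂ λ x y → f x y ≡ c) → c ∈ cartesianProductWith f xs ys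
  member _ (x , y , refl) = ∈-cartesianProductWith⁺ f (complete ex x) (complete ey y)

allFin-enumeration : ∀ n → IsEnumeration (allFin n)
allFin-enumeration n = record { unique = Unique.allFin⁺ n ; complete = ∈-allFin }

allPairs-enumeration : ∀ n → IsEnumeration (cartesianProduct (allFin n) (allFin n))
allPairs-enumeration n = enumeration-cartesianProductWith _,_
  (λ { refl → refl , refl }) (λ (x , y) → x , y , refl)
  (allFin-enumeration n) (allFin-enumeration n)

-- The recursive clause of allVecs is a cartesian product.
concatMap≡cartesianProductWith : (f : A → B → C) (xs : List A) (ys : List B) →
  concatMap (λ x → map (f x) ys) xs ≡ cartesianProductWith f xs ys
concatMap≡cartesianProductWith f []       ys = refl
concatMap≡cartesianProductWith f (x ∷ xs) ys =
  cong (map (f x) ys ++_) (concatMap≡cartesianProductWith f xs ys)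

allVecs-enumeration : ∀ n k → IsEnumeration (allVecs n k)
allVecs-enumeration n zero = record
  { unique = []ᴬ AllPairs.∷ AllPairs.[] ; complete = λ { [] → here refl } }
allVecs-enumeration n (suc k) =
  subst IsEnumeration (sym (concatMap≡cartesianProductWith _∷_ (allFin n) (allVecs n k)))
    (enumeration-cartesianProductWith _∷_ ∷-injective (λ { (x ∷ v) → x , v , refl })
      (allFin-enumeration n) (allVecs-enumeration n k))

-- Arithmetic of opposite (toℕ (opposite a) = n − 1 − a).

opposite-below : ∀ i (a : Fin n) → (toℕ (opposite a) <ᵇ n ∸ i) ≡ not (toℕ a <ᵇ i)
opposite-below {n} i a =
  same-truth (<ᵇ-reflects-< _ _) (¬-reflects (<ᵇ-reflects-< _ _)) above below
  where
  above : toℕ (opposite a) < n ∸ i → ¬ toℕ a < i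
  above h a<i = <⇒≱ (subst (_< n ∸ i) (opposite-prop a) h) (∸-monoʳ-≤ n a<i)
  below : ¬ toℕ a < i → toℕ (opposite a) < n ∸ i
  below a≮i = subst (_< n ∸ i) (sym (opposite-prop a)) (∸-monoʳ-< (s≤s (≮⇒≥ a≮i)) (toℕ<n a))

below-∸ : ∀ i (p : Fin n) → (toℕ p <ᵇ n ∸ i) ≡ not (toℕ (opposite p) <ᵇ i)
below-∸ {n} i p =
  trans (cong (λ q → toℕ q <ᵇ n ∸ i) (sym (opposite-involutive p))) (opposite-below i (opposite p))

not-<ᵇ-suc : ∀ x y → not (x <ᵇ suc y) ≡ (y <ᵇ x)
not-<ᵇ-suc zero    y       = refl
not-<ᵇ-suc (suc x) zero    = refl
not-<ᵇ-suc (suc x) (suc y) = not-<ᵇ-suc x y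

opposite-<ᵇ : (a b : Fin n) → (toℕ (opposite a) <ᵇ toℕ (opposite b)) ≡ (toℕ b <ᵇ toℕ a)
opposite-<ᵇ {n} a b = begin
  toℕ (opposite a) <ᵇ toℕ (opposite b)    ≡⟨ cong (toℕ (opposite a) <ᵇ_) (opposite-prop b) ⟩
  toℕ (opposite a) <ᵇ n ∸ suc (toℕ b)   ≡⟨ opposite-below (suc (toℕ b)) a ⟩
  not (toℕ a <ᵇ suc (toℕ b))            ≡⟨ not-<ᵇ-suc (toℕ a) (toℕ b) ⟩
  toℕ b <ᵇ toℕ a                        ∎
  where open ≡-Reasoning

IsPerm : Vec (Fin n) n → Set
IsPerm v = Injective _≡_ _≡_ (lookup v)

isPerm-reflects : (v : Vec (Fin n) n) → Reflects (IsPerm v) (isPerm v)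
isPerm-reflects v = reflects-map (λ h {i} {j} → h i j) (λ h i j → h)
  (∀Fin-reflects λ i → ∀Fin-reflects λ j →
     ⇒-reflects (==ᶠ-reflects (lookup v i) (lookup v j)) (==ᶠ-reflects i j))

injective⇒surjective : {f : Fin n → Fin n} → Injective _≡_ _≡_ f → ∀ y → ∃ λ i → f i ≡ y
injective⇒surjective {suc n} {f} f-injective y with any? (λ i → f i ≟ y)
... | yes hit = hit
... | no miss = ⊥-elim (1+n≰n (injective⇒≤ g-injective))
  where
  -- f with the missed value y removed from its codomain
  g : Fin (suc n) → Fin n
  g i = punchOut {i = y} {j = f i} (λ e → miss (i , sym e))
  g-injective : Injective _≡_ _≡_ g
  g-injective {i} {j} e =
    f-injective (punchOut-injective (λ e → miss (i , sym e)) (λ e → miss (j , sym e)) e)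

reverseComplement : Vec (Fin n) n → Vec (Fin n) n
reverseComplement v = tabulate (opposite ∘ lookup v ∘ opposite)

lookup-rc : (v : Vec (Fin n) n) (p : Fin n) →
  lookup (reverseComplement v) p ≡ opposite (lookup v (opposite p))
lookup-rc v p = lookup∘tabulate _ p

lookup-rc-opposite : (v : Vec (Fin n) n) (p : Fin n) →
  lookup (reverseComplement v) (opposite p) ≡ opposite (lookup v p)
lookup-rc-opposite v p =
  trans (lookup-rc v (opposite p)) (cong (opposite ∘ lookup v) (opposite-involutive p))

rc-involutive : Involutive _≡_ (reverseComplement {n})
rc-involutive v = trans
  (tabulate-cong λ p → trans (cong opposite (lookup-rc-opposite v p)) (opposite-involutive (lookup v p)))
  (tabulate∘lookup v)

opposite-injective : Injective _≡_ _≡_ (opposite {n})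
opposite-injective = involutive⇒injective opposite opposite-involutive

perm-rc : (v : Vec (Fin n) n) → IsPerm v → IsPerm (reverseComplement v)
perm-rc v perm {i} {j} e =
  opposite-injective (perm (opposite-injective (trans (sym (lookup-rc v i)) (trans e (lookup-rc v j)))))

isPerm-rc : (v : Vec (Fin n) n) → isPerm (reverseComplement v) ≡ isPerm v
isPerm-rc v = same-truth (isPerm-reflects (reverseComplement v)) (isPerm-reflects v)
  (λ perm → subst IsPerm (rc-involutive v) (perm-rc (reverseComplement v) perm)) (perm-rc v)

isInversion : Vec (Fin n) n → Fin n × Fin n → Bool
isInversion v = uncurry λ i j → (toℕ i <ᵇ toℕ j) ∧ (toℕ (lookup v j) <ᵇ toℕ (lookup v i))

length-concatMap-filter : (r : A → B → Bool) (xs : List A) (ys : List B) →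
  length (concatMap (λ x → filterᵇ (r x) ys) xs) ≡ length (filterᵇ (uncurry r) (cartesianProduct xs ys))
length-concatMap-filter r []       ys = refl
length-concatMap-filter r (x ∷ xs) ys = begin
  length (filterᵇ (r x) ys ++ concatMap (λ x → filterᵇ (r x) ys) xs)
    ≡⟨ length-++ (filterᵇ (r x) ys) ⟩
  length (filterᵇ (r x) ys) + length (concatMap (λ x → filterᵇ (r x) ys) xs)
    ≡⟨ cong₂ _+_ (sym (length-filter-map (uncurry r) (x ,_) ys)) (length-concatMap-filter r xs ys) ⟩
  length (filterᵇ (uncurry r) (map (x ,_) ys)) + length (filterᵇ (uncurry r) (cartesianProduct xs ys))
    ≡⟨ length-++ (filterᵇ (uncurry r) (map (x ,_) ys)) ⟨
  length (filterᵇ (uncurry r) (map (x ,_) ys) ++ filterᵇ (uncurry r) (cartesianProduct xs ys))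
    ≡⟨ cong length (filter-++ (T? ∘ uncurry r) (map (x ,_) ys) (cartesianProduct xs ys)) ⟨
  length (filterᵇ (uncurry r) (cartesianProduct (x ∷ xs) ys))
    ∎
  where open ≡-Reasoning

inversions-count : (v : Vec (Fin n) n) →
  inversions v ≡ length (filterᵇ (isInversion v) (cartesianProduct (allFin n) (allFin n)))
inversions-count {n} v = length-concatMap-filter _ (allFin n) (allFin n)

-- (i, j) ↦ (opp j, opp i): the involution matching inversions of σ and ρσ.
swapOpposite : Fin n × Fin n → Fin n × Fin n
swapOpposite (i , j) = opposite j , opposite i

swapOpposite-involutive : Involutive _≡_ (swapOpposite {n})
swapOpposite-involutive (i , j) = cong₂ _,_ (opposite-involutive i) (opposite-involutive j)

inversion-rc : (v : Vec (Fin n) n) (ij : Fin n × Fin n) →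
  isInversion v ij ≡ isInversion (reverseComplement v) (swapOpposite ij)
inversion-rc v (i , j) = sym (cong₂ _∧_ (opposite-<ᵇ j i) (begin
  toℕ (lookup ρv (opposite i)) <ᵇ toℕ (lookup ρv (opposite j))
    ≡⟨ cong₂ (λ x y → toℕ x <ᵇ toℕ y) (lookup-rc-opposite v i) (lookup-rc-opposite v j) ⟩
  toℕ (opposite (lookup v i)) <ᵇ toℕ (opposite (lookup v j))
    ≡⟨ opposite-<ᵇ (lookup v i) (lookup v j) ⟩
  toℕ (lookup v j) <ᵇ toℕ (lookup v i)
    ∎))
  where
  open ≡-Reasoning
  ρv = reverseComplement v

inversions-rc : (v : Vec (Fin n) n) → inversions v ≡ inversions (reverseComplement v)
inversions-rc {n} v = begin
  inversions v
    ≡⟨ inversions-count v ⟩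
  length (filterᵇ (isInversion v) pairs)
    ≡⟨ count-involution (allPairs-enumeration n) swapOpposite swapOpposite-involutive (inversion-rc v) ⟩
  length (filterᵇ (isInversion (reverseComplement v)) pairs)
    ≡⟨ inversions-count (reverseComplement v) ⟨
  inversions (reverseComplement v)
    ∎
  where
  open ≡-Reasoning
  pairs = cartesianProduct (allFin n) (allFin n)

inPrefix-reflects : (v : Vec (Fin n) n) (i : ℕ) (x : Fin n) →
  Reflects (∃ λ p → toℕ p < i × lookup v p ≡ x) (inPrefix v i x)
inPrefix-reflects v i x = ∃Fin-reflects λ p → <ᵇ-reflects-< (toℕ p) i ×-reflects ==ᶠ-reflects (lookup v p) x

inPrefix-at : (v : Vec (Fin n) n) → IsPerm v → ∀ i p → inPrefix v i (lookup v p) ≡ (toℕ p <ᵇ i)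
inPrefix-at v perm i p = same-truth (inPrefix-reflects v i (lookup v p)) (<ᵇ-reflects-< (toℕ p) i)
  (λ (q , q<i , e) → subst (λ r → toℕ r < i) (perm e) q<i) (λ p<i → p , p<i , refl)

-- v maps the positions below i to values below i and the others to values
-- not below i; for permutations this is decomposability at i.
Closed : Vec (Fin n) n → ℕ → Set
Closed v i = ∀ p → (toℕ p <ᵇ i) ≡ (toℕ (lookup v p) <ᵇ i)

decomposable-reflects : (v : Vec (Fin n) n) → IsPerm v → ∀ i → Reflects (Closed v i) (decomposableAt v i)
decomposable-reflects v perm i =
  reflects-map closed prefix (∀Fin-reflects λ x → xnor-reflects (inPrefix v i x) (toℕ x <ᵇ i))
  where
  closed : (∀ x → inPrefix v i x ≡ (toℕ x <ᵇ i)) → Closed v i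
  closed h p = trans (sym (inPrefix-at v perm i p)) (h (lookup v p))
  prefix : Closed v i → ∀ x → inPrefix v i x ≡ (toℕ x <ᵇ i)
  prefix c x with injective⇒surjective perm x
  ... | p , refl = trans (inPrefix-at v perm i p) (c p)

value-rc-below : (v : Vec (Fin n) n) (i : ℕ) (p : Fin n) →
  (toℕ (lookup (reverseComplement v) p) <ᵇ n ∸ i) ≡ not (toℕ (lookup v (opposite p)) <ᵇ i)
value-rc-below {n} v i p =
  trans (cong (λ x → toℕ x <ᵇ n ∸ i) (lookup-rc v p)) (opposite-below i (lookup v (opposite p)))

closed-rc : (v : Vec (Fin n) n) (i : ℕ) → Closed v i → Closed (reverseComplement v) (n ∸ i)
closed-rc {n} v i c p = begin
  toℕ p <ᵇ n ∸ i                                 ≡⟨ below-∸ i p ⟩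
  not (toℕ (opposite p) <ᵇ i)                    ≡⟨ cong not (c (opposite p)) ⟩
  not (toℕ (lookup v (opposite p)) <ᵇ i)         ≡⟨ value-rc-below v i p ⟨
  toℕ (lookup (reverseComplement v) p) <ᵇ n ∸ i  ∎
  where open ≡-Reasoning

closed-rc⁻ : (v : Vec (Fin n) n) (i : ℕ) → Closed (reverseComplement v) (n ∸ i) → Closed v i
closed-rc⁻ {n} v i c q =
  subst (λ r → (toℕ r <ᵇ i) ≡ (toℕ (lookup v r) <ᵇ i)) (opposite-involutive q) (not-injective (begin
    not (toℕ (opposite p) <ᵇ i)                    ≡⟨ below-∸ i p ⟨
    toℕ p <ᵇ n ∸ i                                 ≡⟨ c p ⟩
    toℕ (lookup (reverseComplement v) p) <ᵇ n ∸ i  ≡⟨ value-rc-below v i p ⟩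
    not (toℕ (lookup v (opposite p)) <ᵇ i)         ∎))
  where
  open ≡-Reasoning
  p = opposite q

decomposable-rc : (v : Vec (Fin n) n) → IsPerm v → ∀ i →
  decomposableAt v i ≡ decomposableAt (reverseComplement v) (n ∸ i)
decomposable-rc {n} v perm i =
  same-truth (decomposable-reflects v perm i)
    (decomposable-reflects (reverseComplement v) (perm-rc v perm) (n ∸ i))
    (closed-rc v i) (closed-rc⁻ v i)

unionLow-rc : (v : Vec (Fin n) n) → IsPerm v → ∀ k → unionLow k v ≡ unionHigh k (reverseComplement v)
unionLow-rc v perm k = cong or (map-cong (decomposable-rc v perm) (oneTo k))

restrictedEvent-rc : ∀ m (E F : Vec (Fin n) n → Bool) →
  (∀ v → IsPerm v → E v ≡ F (reverseComplement v)) → ∀ v →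
  (isPerm v ∧ (inversions v ≡ᵇ m) ∧ E v) ≡
  (isPerm (reverseComplement v) ∧ (inversions (reverseComplement v) ≡ᵇ m) ∧ F (reverseComplement v))
restrictedEvent-rc m E F E≡F v with isPerm v | isPerm-reflects v | isPerm-rc v
... | false | _         | ρv-not-perm rewrite ρv-not-perm = refl
... | true  | ofʸ perm  | ρv-perm     rewrite ρv-perm =
  cong₂ (λ c e → (c ≡ᵇ m) ∧ e) (inversions-rc v) (E≡F v perm)

corollary3p3 : (n m k : ℕ) → 2 ≤ n → 1 ≤ k → 2 * k ≤ n →
    countEvent n m (unionLow k) ≡ countEvent n m (unionHigh k)
corollary3p3 n m k _ _ _ =
  count-involution (allVecs-enumeration n n) reverseComplement rc-involutive
    (restrictedEvent-rc m (unionLow k) (unionHigh k) (λ v perm → unionLow-rc v perm k))
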